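{- Let $\mathbb L$ be a class of linear orders. Then $\overline{\mathbb L}=\mathbb L_\infty$.
   Context: The $L$-sum $\sum_{i\in L}L_i$ of linear orders is their disjoint union ordered within each $L_i$ and by $a<b$ whenever $a\in L_i,b\in L_j$, $i<j$. $\overline{\mathbb L}$ is the least class containing $\mathbb L$ and all finite linear orders (the finite ordinals) and closed under $L$-sums for every $L\in\overline{\mathbb L}$. Define $\mathbb L_0=\mathbb L\cup\omega$ (i.e. $\mathbb L$ together with the finite ordinals), $\mathbb L_{\alpha+1}=\{\sum_{i\in L}L_i: L\in\mathbb L_0, L_i\in\mathbb L_\alpha\}$, $\mathbb L_\lambda=\bigcup_{\gamma<\lambda}\mathbb L_\gamma$ for limit $\lambda$, and $\mathbb L_\infty=\bigcup_{\alpha\in\mathrm{On}}\mathbb L_\alpha$. Classes are understood up to isomorphism. -}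

module Defs where

open import Level using (Level; _⊔_; Lift; lift) renaming (suc to lsuc)
open import Data.Nat using (ℕ)
open import Data.Fin using (Fin)
import Data.Fin as Fin
open import Data.Product using (Σ; Σ-syntax; ∃; _×_; _,_)
open import Data.Sum using (_⊎_)
open import Relation.Binary.PropositionalEquality using (_≡_; _≢_; subst)
open import Relation.Nullary using (¬_)

record Str (ℓ : Level) : Set (lsuc ℓ) where
  field
    Carrier : Set ℓ
    _<_     : Carrier → Carrier → Set ℓ

open Str public

record IsLinOrder {ℓ : Level} (X : Str ℓ) : Set ℓ where
  field
    irrefl    : ∀ x → ¬ (_<_ X x x)
    trans     : ∀ {x y z} → _<_ X x y → _<_ X y z → _<_ X x z
    connected : ∀ {x y} → x ≢ y → _<_ X x y ⊎ _<_ X y x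

record _≅_ {ℓ : Level} (X Y : Str ℓ) : Set ℓ where
  field
    to       : Carrier X → Carrier Y
    from     : Carrier Y → Carrier X
    from∘to  : ∀ x → from (to x) ≡ x
    to∘from  : ∀ y → to (from y) ≡ y
    to-mono  : ∀ {x y} → _<_ X x y → _<_ Y (to x) (to y)
    to-refl  : ∀ {x y} → _<_ Y (to x) (to y) → _<_ X x y

finOrd : {ℓ : Level} → ℕ → Str ℓ
finOrd {ℓ} n = record
  { Carrier = Lift ℓ (Fin n)
  ; _<_ = λ { (lift a) (lift b) → Lift ℓ (a Fin.< b) } }

lsum : {ℓ : Level} (L : Str ℓ) → (Carrier L → Str ℓ) → Str ℓ
lsum L F = record
  { Carrier = Σ (Carrier L) (λ i → Carrier (F i))
  ; _<_ = λ { (i , a) (j , b) →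
        _<_ L i j
      ⊎ Σ (i ≡ j) (λ p → _<_ (F j) (subst (λ k → Carrier (F k)) p a) b) } }

-- A class of structures is a predicate; membership is read up to isomorphism.
Class : (ℓ ℓ' : Level) → Set (lsuc ℓ ⊔ lsuc ℓ')
Class ℓ ℓ' = Str ℓ → Set ℓ'

data Closure {ℓ ℓ' : Level} (𝕃 : Class ℓ ℓ') : Str ℓ → Set (lsuc ℓ ⊔ ℓ') where
  base : ∀ {X} → 𝕃 X → Closure 𝕃 X
  fin  : ∀ n → Closure 𝕃 (finOrd n)
  sum  : ∀ (L : Str ℓ) (F : Carrier L → Str ℓ) →
         Closure 𝕃 L → (∀ i → Closure 𝕃 (F i)) → Closure 𝕃 (lsum L F)
  iso  : ∀ {X Y} → Closure 𝕃 X → X ≅ Y → Closure 𝕃 Y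

data Ord (ℓ : Level) : Set (lsuc ℓ) where
  ozero : Ord ℓ
  osuc  : Ord ℓ → Ord ℓ
  olim  : (I : Set ℓ) → (I → Ord ℓ) → Ord ℓ

L₀ : {ℓ ℓ' : Level} → Class ℓ ℓ' → Str ℓ → Set (lsuc ℓ ⊔ ℓ')
L₀ 𝕃 X = (Σ[ Y ∈ _ ] (𝕃 Y × X ≅ Y)) ⊎ (Σ[ n ∈ ℕ ] (X ≅ finOrd n))

Lα : {ℓ ℓ' : Level} → Class ℓ ℓ' → Ord ℓ → Str ℓ → Set (lsuc ℓ ⊔ ℓ')
Lα 𝕃 ozero      X = L₀ 𝕃 X
Lα 𝕃 (osuc α)   X =
  Σ[ L ∈ Str _ ] Σ[ F ∈ (Carrier L → Str _) ]
    (L₀ 𝕃 L × (∀ i → Lα 𝕃 α (F i)) × X ≅ lsum L F)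
Lα 𝕃 (olim I f) X = Σ[ i ∈ I ] Lα 𝕃 (f i) X

L∞ : {ℓ ℓ' : Level} → Class ℓ ℓ' → Str ℓ → Set (lsuc ℓ ⊔ ℓ')
L∞ {ℓ} 𝕃 X = Σ[ α ∈ Ord ℓ ] Lα 𝕃 α X

-- Every level 𝕃_α is built from 𝕃, finite ordinals, sums and isomorphic
-- copies, so 𝕃_∞ ⊆ \overline{𝕃}. Conversely 𝕃_∞ contains 𝕃 and ω and is
-- closed under isomorphism; the point is closure under L-sums with L ∈ 𝕃_∞.
-- This goes by induction on the level of L: if L ≅ Σ_{j∈M} G_j with M ∈ 𝕃₀,
-- then Σ_{i∈L} F_i ≅ Σ_{j∈M} Σ_{k∈G_j} F_{(j,k)}, whose inner sums lie in
-- 𝕃_∞ by induction, and an 𝕃₀-sum of members of 𝕃_∞ lies one level above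
-- the supremum of their levels.
module Submission where

open import Defs
open import Level using (Level)
open import Function.Bundles using (_⇔_; mk⇔)
open import Data.Product using (_,_; proj₁; proj₂)
open import Data.Sum using (inj₁; inj₂)
open import Relation.Binary.PropositionalEquality
  using (_≡_; refl; sym; trans; cong; subst; subst₂)

module _ {ℓ : Level} where

  ≅-refl : {X : Str ℓ} → X ≅ X
  ≅-refl = record
    { to = λ x → x ; from = λ x → x
    ; from∘to = λ _ → refl ; to∘from = λ _ → refl
    ; to-mono = λ h → h ; to-refl = λ h → h }

  ≅-sym : {X Y : Str ℓ} → X ≅ Y → Y ≅ X
  ≅-sym {X} {Y} e = record
    { to = from ; from = to
    ; from∘to = to∘from ; to∘from = from∘to
    ; to-mono = λ {x} {y} h → to-refl (subst₂ (_<_ Y) (sym (to∘from x)) (sym (to∘from y)) h)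
    ; to-refl = λ {x} {y} h → subst₂ (_<_ Y) (to∘from x) (to∘from y) (to-mono h) }
    where open _≅_ e

  ≅-trans : {X Y Z : Str ℓ} → X ≅ Y → Y ≅ Z → X ≅ Z
  ≅-trans e f = record
    { to = λ x → F.to (E.to x) ; from = λ z → E.from (F.from z)
    ; from∘to = λ x → trans (cong E.from (F.from∘to (E.to x))) (E.from∘to x)
    ; to∘from = λ z → trans (cong F.to (E.to∘from (F.from z))) (F.to∘from z)
    ; to-mono = λ h → F.to-mono (E.to-mono h)
    ; to-refl = λ h → E.to-refl (F.to-refl h) }
    where module E = _≅_ e
          module F = _≅_ f

  ≅-injective : {X Y : Str ℓ} (e : X ≅ Y) {x x' : Carrier X} →
                _≅_.to e x ≡ _≅_.to e x' → x ≡ x'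
  ≅-injective e {x} {x'} p = trans (sym (from∘to x)) (trans (cong from p) (from∘to x'))
    where open _≅_ e

  lsum-reindex : {A B : Str ℓ} (e : A ≅ B) (G : Carrier B → Str ℓ) →
                 lsum A (λ i → G (_≅_.to e i)) ≅ lsum B G
  lsum-reindex {A} {B} e G = record
    { to = λ { (i , a) → E.to i , a }
    ; from = λ { (j , b) → E.from j , subst CG (sym (E.to∘from j)) b }
    ; from∘to = λ { (i , a) → from-to (E.from∘to i) (E.to∘from (E.to i)) a }
    ; to∘from = λ { (j , b) → to-from (E.to∘from j) b }
    ; to-mono = mono
    ; to-refl = reflect }
    where
    module E = _≅_ e
    CG : Carrier B → Set ℓ
    CG j = Carrier (G j)
    ΣA = lsum A (λ i → G (E.to i))

    from-to : ∀ {x i} → x ≡ i → (q : E.to x ≡ E.to i) (a : CG (E.to i)) →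
              _≡_ {A = Carrier ΣA} (x , subst CG (sym q) a) (i , a)
    from-to refl refl a = refl

    to-from : ∀ {x j} (p : x ≡ j) (b : CG j) →
              _≡_ {A = Carrier (lsum B G)} (x , subst CG (sym p) b) (j , b)
    to-from refl b = refl

    mono : ∀ {x y} → _<_ ΣA x y →
           _<_ (lsum B G) (E.to (proj₁ x) , proj₂ x) (E.to (proj₁ y) , proj₂ y)
    mono (inj₁ h) = inj₁ (E.to-mono h)
    mono (inj₂ (refl , h)) = inj₂ (refl , h)

    reflect-fibre : ∀ {i i'} → i ≡ i' → (p : E.to i ≡ E.to i') → ∀ a a' →
                    _<_ (G (E.to i')) (subst CG p a) a' → _<_ ΣA (i , a) (i' , a')
    reflect-fibre refl refl a a' h = inj₂ (refl , h)

    reflect : ∀ {x y} →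
              _<_ (lsum B G) (E.to (proj₁ x) , proj₂ x) (E.to (proj₁ y) , proj₂ y) →
              _<_ ΣA x y
    reflect (inj₁ h) = inj₁ (E.to-refl h)
    reflect {_ , a} {_ , a'} (inj₂ (p , h)) = reflect-fibre (≅-injective e p) p a a' h

  lsum-assoc : (M : Str ℓ) (G : Carrier M → Str ℓ) (F : Carrier (lsum M G) → Str ℓ) →
               lsum (lsum M G) F ≅ lsum M (λ j → lsum (G j) (λ k → F (j , k)))
  lsum-assoc M G F = record
    { to = λ { ((j , k) , a) → j , (k , a) }
    ; from = λ { (j , (k , a)) → (j , k) , a }
    ; from∘to = λ _ → refl ; to∘from = λ _ → refl
    ; to-mono = mono ; to-refl = reflect }
    where
    ΣΣ = lsum (lsum M G) F
    ΣΣ′ = lsum M (λ j → lsum (G j) (λ k → F (j , k)))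

    mono : ∀ {x y} → _<_ ΣΣ x y →
           _<_ ΣΣ′ (proj₁ (proj₁ x) , (proj₂ (proj₁ x) , proj₂ x))
                   (proj₁ (proj₁ y) , (proj₂ (proj₁ y) , proj₂ y))
    mono (inj₁ (inj₁ h)) = inj₁ h
    mono (inj₁ (inj₂ (refl , h))) = inj₂ (refl , inj₁ h)
    mono (inj₂ (refl , h)) = inj₂ (refl , inj₂ (refl , h))

    reflect : ∀ {x y} →
              _<_ ΣΣ′ (proj₁ (proj₁ x) , (proj₂ (proj₁ x) , proj₂ x))
                      (proj₁ (proj₁ y) , (proj₂ (proj₁ y) , proj₂ y)) →
              _<_ ΣΣ x y
    reflect (inj₁ h) = inj₁ (inj₁ h)
    reflect (inj₂ (refl , inj₁ h)) = inj₁ (inj₂ (refl , h))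
    reflect (inj₂ (refl , inj₂ (refl , h))) = inj₂ (refl , h)

module _ {ℓ ℓ' : Level} (𝕃 : Class ℓ ℓ') where

  L₀-resp-≅ : ∀ {X Y} → L₀ 𝕃 X → X ≅ Y → L₀ 𝕃 Y
  L₀-resp-≅ (inj₁ (Z , z , e)) f = inj₁ (Z , z , ≅-trans (≅-sym f) e)
  L₀-resp-≅ (inj₂ (n , e))     f = inj₂ (n , ≅-trans (≅-sym f) e)

  Lα-resp-≅ : ∀ α {X Y} → Lα 𝕃 α X → X ≅ Y → Lα 𝕃 α Y
  Lα-resp-≅ ozero      x                    f = L₀-resp-≅ x f
  Lα-resp-≅ (osuc α)   (L , F , l , Fs , e) f = L , F , l , Fs , ≅-trans (≅-sym f) e
  Lα-resp-≅ (olim I g) (i , x)              f = i , Lα-resp-≅ (g i) x f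

  L∞-resp-≅ : ∀ {X Y} → L∞ 𝕃 X → X ≅ Y → L∞ 𝕃 Y
  L∞-resp-≅ (α , x) f = α , Lα-resp-≅ α x f

  L∞-sum-L₀ : ∀ L (F : Carrier L → Str ℓ) → L₀ 𝕃 L → (∀ i → L∞ 𝕃 (F i)) →
              L∞ 𝕃 (lsum L F)
  L∞-sum-L₀ L F l Fs =
    osuc (olim (Carrier L) (λ i → proj₁ (Fs i))) ,
    L , F , l , (λ i → i , proj₂ (Fs i)) , ≅-refl

  L∞-sum-Lα : ∀ α L (F : Carrier L → Str ℓ) → Lα 𝕃 α L → (∀ i → L∞ 𝕃 (F i)) →
              L∞ 𝕃 (lsum L F)
  L∞-sum-Lα ozero      L F l       Fs = L∞-sum-L₀ L F l Fs
  L∞-sum-Lα (olim I g) L F (i , l) Fs = L∞-sum-Lα (g i) L F l Fs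
  L∞-sum-Lα (osuc α)   L F (M , G , m , Gs , e) Fs =
    L∞-resp-≅ (L∞-sum-L₀ M H m H∈L∞)
              (≅-trans (≅-sym (lsum-assoc M G F′)) (lsum-reindex (≅-sym e) F))
    where
    F′ : Carrier (lsum M G) → Str ℓ
    F′ x = F (_≅_.from e x)
    H : Carrier M → Str ℓ
    H j = lsum (G j) (λ k → F′ (j , k))
    H∈L∞ : ∀ j → L∞ 𝕃 (H j)
    H∈L∞ j = L∞-sum-Lα α (G j) (λ k → F′ (j , k)) (Gs j) (λ k → Fs (_≅_.from e (j , k)))

  L∞-sum : ∀ L (F : Carrier L → Str ℓ) → L∞ 𝕃 L → (∀ i → L∞ 𝕃 (F i)) →
           L∞ 𝕃 (lsum L F)
  L∞-sum L F (α , l) = L∞-sum-Lα α L F l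

  Closure⇒L∞ : ∀ {X} → Closure 𝕃 X → L∞ 𝕃 X
  Closure⇒L∞ (base x)       = ozero , inj₁ (_ , x , ≅-refl)
  Closure⇒L∞ (fin n)        = ozero , inj₂ (n , ≅-refl)
  Closure⇒L∞ (sum L F l Fs) = L∞-sum L F (Closure⇒L∞ l) (λ i → Closure⇒L∞ (Fs i))
  Closure⇒L∞ (iso x e)      = L∞-resp-≅ (Closure⇒L∞ x) e

  L₀⇒Closure : ∀ {X} → L₀ 𝕃 X → Closure 𝕃 X
  L₀⇒Closure (inj₁ (Y , y , e)) = iso (base y) (≅-sym e)
  L₀⇒Closure (inj₂ (n , e))     = iso (fin n) (≅-sym e)

  Lα⇒Closure : ∀ α {X} → Lα 𝕃 α X → Closure 𝕃 X
  Lα⇒Closure ozero      x                    = L₀⇒Closure x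
  Lα⇒Closure (osuc α)   (L , F , l , Fs , e) =
    iso (sum L F (L₀⇒Closure l) (λ i → Lα⇒Closure α (Fs i))) (≅-sym e)
  Lα⇒Closure (olim I g) (i , x)              = Lα⇒Closure (g i) x

  L∞⇒Closure : ∀ {X} → L∞ 𝕃 X → Closure 𝕃 X
  L∞⇒Closure (α , x) = Lα⇒Closure α x

lemma5p5 : {ℓ ℓ' : Level} (𝕃 : Class ℓ ℓ') →
           (∀ X → 𝕃 X → IsLinOrder X) →
           ∀ (X : Str ℓ) → Closure 𝕃 X ⇔ L∞ 𝕃 X
lemma5p5 𝕃 _ X = mk⇔ (Closure⇒L∞ 𝕃) (L∞⇒Closure 𝕃)
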